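{- Let $[a,b]$ be an interval and $S$ a finite set of sensors with coverage intervals $[u_s,v_s]$. Suppose continuous OGA (defined in the context) was applied to select a set $S^{\mathrm{old}}\subseteq S$ covering $[a,b]$, and then exactly one sensor $s^*\in S^{\mathrm{old}}$ fails, producing a single gap $[u_G,v_G]$ (the part of $s^*$'s interval no longer covered by $S^{\mathrm{old}}\setminus\{s^*\}$). Assume $S\setminus\{s^*\}$ still covers $[a,b]$. Let $n_{OGA}$ be the number of sensors selected by a new run of continuous OGA on $[a,b]$ using $S\setminus\{s^*\}$, and let $n_{LOGM}$ be the number of sensors in the solution produced by LOGM (defined in the context). Then $n_{OGA}\le n_{LOGM}\le n_{OGA}+1$.
   Context: Continuous OGA for covering $[\alpha,\beta]$: set the current point $p=\alpha$; repeatedly select, among the available not-yet-selected sensors whose interval contains $p$, one with the largest right endpoint (ties broken in favor of the longest interval), and set $p$ to that right endpoint; stop once $p\ge\beta$. LOGM (locally optimal gap mending): keep all sensors of $S^{\mathrm{old}}\setminus\{s^*\}$, and additionally run continuous OGA on the gap $[u_G,v_G]$, starting from $u_G$ and stopping once $v_G$ is covered, using only the sensors of $S$ that were not in $S^{\mathrm{old}}$; the LOGM solution is the union of the kept and newly selected sensors.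
   Formalization: The endpoints of the coverage intervals $[u_s,v_s]$, of the interval $[a,b]$ and of the gap $[u_G,v_G]$ are taken in ℚ. -}

module Defs where

open import Data.Nat using (ℕ)
open import Data.Fin using (Fin; _≟_)
open import Data.Rational using (ℚ; _≤_; _<_)
open import Data.List using (List; []; _∷_; filter; _++_; length)
open import Data.Product using (_×_; ∃)
open import Data.Empty using (⊥)
open import Relation.Nullary using (¬_; ¬?)
open import Relation.Binary.PropositionalEquality using (_≡_; _≢_)

record Sensors (n : ℕ) : Set where
  field
    u : Fin n → ℚ
    v : Fin n → ℚ
    u≤v : ∀ i → u i ≤ v i
open Sensors public

_∋ₛ_ : ∀ {n} → (S : Sensors n) → Fin n → ℚ → Set
_∋ₛ_ S i x = (u S i ≤ x) × (x ≤ v S i)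

CoveredBy : ∀ {n} → Sensors n → (Fin n → Set) → ℚ → Set
CoveredBy S P x = ∃ λ i → P i × (_∋ₛ_ S i x)

Covers : ∀ {n} → Sensors n → (Fin n → Set) → ℚ → ℚ → Set
Covers S P a b = ∀ x → a ≤ x → x ≤ b → CoveredBy S P x

-- Continuous OGA as a relation:
-- OGA S avail p β sel  means: starting at the current point p, with the
-- set avail of available not-yet-selected sensors, continuous OGA
-- (run until p ≥ β) selects the sensors sel, in order.
-- Choice: among available sensors whose interval contains p, one with the
-- largest right endpoint, ties broken in favour of the longest interval
-- (i.e. the smallest left endpoint among equal right endpoints).
data OGA {n : ℕ} (S : Sensors n) : (Fin n → Set) → ℚ → ℚ → List (Fin n) → Set₁ where
  stop : ∀ {avail p β} → β ≤ p → OGA S avail p β []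
  step : ∀ {avail p β sel} (i : Fin n) →
         p < β →
         avail i →
         _∋ₛ_ S i p →
         (∀ j → avail j → _∋ₛ_ S j p →
            (v S j ≤ v S i) × (v S j ≡ v S i → u S i ≤ u S j)) →
         OGA S (λ j → avail j × j ≢ i) (v S i) β sel →
         OGA S avail p β (i ∷ sel)

removeₛ : ∀ {n} → Fin n → List (Fin n) → List (Fin n)
removeₛ s xs = filter (λ i → ¬? (i ≟ s)) xs

{-# OPTIONS --safe #-}
module Submission where

-- Greedy stays ahead: if a list C of available sensors covers (p, q] with q at or past the target,
-- OGA started at p selects at most |C| sensors. The lower bound follows because the kept and the
-- mending sensors together cover [a, b] without s*. For the upper bound, cut the new run at its
-- first sensor passing uG and at its first sensor reaching vG. The old run, truncated just after uG,
-- stays ahead of the new run up to the first cut, so it already contains s*, which spans the gap;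
-- continuing with the new run from the second cut bounds |S^old|. The part between the cuts meets
-- the gap, hence avoids S^old and bounds the mending run. Only the two cut sensors are counted
-- twice, and S^old ∖ {s*} has one sensor fewer than S^old.

open import Defs
open import Data.Nat using (ℕ; suc; z≤n; s≤s; _+_) renaming (_≤_ to _≤ℕ_; _<_ to _<ℕ_)
open import Data.Nat.Properties using (≤-pred; ≤-reflexive; +-mono-≤; +-monoˡ-≤; +-suc; +-comm; +-assoc; module ≤-Reasoning)
  renaming (≤-trans to ≤ℕ-trans)
open import Data.Fin using (Fin; _≟_)
open import Data.Rational using (ℚ; _≤_; _<_)
open import Data.Rational.Properties
  using (≤-refl; ≤-trans; <⇒≤; ≮⇒≥; ≰⇒>; <-irrefl; <-≤-trans; ≤-<-trans; <-trans; <-dense; _≤?_; _<?_)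
open import Data.List using (List; []; _∷_; _++_; _∷ʳ_; length)
open import Data.List.Properties using (length-++; filter-notAll; ∷ʳ-++)
open import Data.List.Membership.Propositional using (_∈_; _∉_; find; lose)
open import Data.List.Membership.Propositional.Properties using (∈-filter⁺; ∈-filter⁻; ∈-++⁺ˡ; ∈-++⁺ʳ)
import Data.List.Membership.DecPropositional as DecMembership
open import Data.List.Relation.Unary.Any using (here; there; any?)
open import Data.Product using (_×_; _,_; proj₁; proj₂; ∃; ∃₂)
import Data.Product as Product
open import Data.Unit using (⊤; tt)
open import Data.Empty using (⊥-elim)
open import Relation.Nullary using (¬_; Dec; yes; no; ¬?)
open import Relation.Nullary.Decidable using (_×-dec_; map′; decidable-stable)
open import Relation.Unary using (Decidable; _⊆_; _∩_)
open import Relation.Unary.Properties using (_∩?_)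
open import Relation.Binary.PropositionalEquality using (_≡_; _≢_; refl; sym; trans; cong; subst; module ≡-Reasoning)

<⇒≱ : ∀ {p q : ℚ} → p < q → ¬ q ≤ p
<⇒≱ p<q q≤p = <-irrefl refl (<-≤-trans p<q q≤p)

dense-below₂ : ∀ {p q r : ℚ} → p < q → p < r → ∃ λ z → p < z × z < q × z < r
dense-below₂ {q = q} {r} p<q p<r with q ≤? r
... | yes q≤r = let z , p<z , z<q = <-dense p<q in z , p<z , z<q , <-≤-trans z<q q≤r
... | no q≰r  = let z , p<z , z<r = <-dense p<r in z , p<z , <-trans z<r (≰⇒> q≰r) , z<r

dense-above₂ : ∀ {p q r : ℚ} → p < r → q < r → ∃ λ z → p < z × q < z × z < r
dense-above₂ {p} {q} p<r q<r with p ≤? q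
... | yes p≤q = let z , q<z , z<r = <-dense q<r in z , ≤-<-trans p≤q q<z , q<z , z<r
... | no p≰q  = let z , p<z , z<r = <-dense p<r in z , p<z , <-trans (≰⇒> p≰q) p<z , z<r

closure-⊆ : ∀ {l r lo hi : ℚ} → l < r → (∀ z → l < z → z < r → lo ≤ z × z ≤ hi) → lo ≤ l × r ≤ hi
closure-⊆ {l} {r} {lo} {hi} l<r inside = lo≤l , r≤hi
  where
  lo≤l : lo ≤ l
  lo≤l = decidable-stable (lo ≤? l) λ lo≰l →
    let z , l<z , z<lo , z<r = dense-below₂ (≰⇒> lo≰l) l<r in <⇒≱ z<lo (proj₁ (inside z l<z z<r))
  r≤hi : r ≤ hi
  r≤hi = decidable-stable (r ≤? hi) λ r≰hi →
    let z , l<z , hi<z , z<r = dense-above₂ l<r (≰⇒> r≰hi) in <⇒≱ hi<z (proj₂ (inside z l<z z<r))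

module _ {n : ℕ} where

  ∈-removeₛ⁺ : ∀ {s c : Fin n} {xs} → c ∈ xs → c ≢ s → c ∈ removeₛ s xs
  ∈-removeₛ⁺ {s} = ∈-filter⁺ (λ i → ¬? (i ≟ s))

  ∈-removeₛ⁻ : ∀ {s c : Fin n} {xs} → c ∈ removeₛ s xs → c ∈ xs × c ≢ s
  ∈-removeₛ⁻ {s} = ∈-filter⁻ (λ i → ¬? (i ≟ s))

  length-removeₛ : ∀ {s : Fin n} {xs} → s ∈ xs → length (removeₛ s xs) <ℕ length xs
  length-removeₛ {s} {xs} s∈xs = filter-notAll (λ i → ¬? (i ≟ s)) xs (lose s∈xs λ s≢s → s≢s refl)

module _ {A : Set} where

  ∈-∷ʳ-++⁺ : ∀ (xs : List A) {y} ys {x} → x ∈ xs ∷ʳ y → x ∈ xs ++ y ∷ ys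
  ∈-∷ʳ-++⁺ xs {y} ys x∈ = subst (_ ∈_) (∷ʳ-++ xs y ys) (∈-++⁺ˡ x∈)

  length-∷ʳ-++ : ∀ (xs : List A) y ys → length (xs ∷ʳ y) + length ys ≡ length (xs ++ y ∷ ys)
  length-∷ʳ-++ xs y ys = trans (sym (length-++ (xs ∷ʳ y))) (cong length (∷ʳ-++ xs y ys))

module _ {n : ℕ} (S : Sensors n) where

  -- Half-open (p, q]: after OGA picks i at p, removing from a cover the sensor containing p leaves
  -- (v i, q] covered, whereas v i itself may be lost.
  CoversAbove : (Fin n → Set) → ℚ → ℚ → Set
  CoversAbove P p q = ∀ x → p < x → x ≤ q → CoveredBy S P x

  coveredBy-mono : ∀ {P Q : Fin n → Set} {x} → P ⊆ Q → CoveredBy S P x → CoveredBy S Q x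
  coveredBy-mono P⊆Q = Product.map₂ (Product.map₁ P⊆Q)

  coversAbove-mono : ∀ {P Q p q} → P ⊆ Q → CoversAbove P p q → CoversAbove Q p q
  coversAbove-mono P⊆Q cov x p<x x≤q = coveredBy-mono P⊆Q (cov x p<x x≤q)

  coversAbove-shrink : ∀ {P p q q′} → q′ ≤ q → CoversAbove P p q → CoversAbove P p q′
  coversAbove-shrink q′≤q cov x p<x x≤q′ = cov x p<x (≤-trans x≤q′ q′≤q)

  coversAbove-join : ∀ {P p q r s} → CoversAbove P p q → r ≤ q → CoversAbove P r s → CoversAbove P p s
  coversAbove-join {q = q} left r≤q right x p<x x≤s with x ≤? q
  ... | yes x≤q = left x p<x x≤q
  ... | no x≰q  = right x (≤-<-trans r≤q (≰⇒> x≰q)) x≤s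

  covers⇒coversAbove : ∀ {P p q} → Covers S P p q → CoversAbove P p q
  covers⇒coversAbove cov x p<x = cov x (<⇒≤ p<x)

  coveredBy? : (C : List (Fin n)) (x : ℚ) → Dec (CoveredBy S (_∈ C) x)
  coveredBy? C x = map′ find (λ (c , c∈C , c∋x) → lose c∈C c∋x)
    (any? (λ c → (u S c ≤? x) ×-dec (x ≤? v S c)) C)

  coversAbove-drop : ∀ {A c C p q} → CoversAbove ((_∈ c ∷ C) ∩ A) p q →
    (∀ x → p < x → x ≤ q → A c → ¬ (S ∋ₛ c) x) → CoversAbove ((_∈ C) ∩ A) p q
  coversAbove-drop cov misses x p<x x≤q with cov x p<x x≤q
  ... | _  , (here refl , Ac) , c∋x   = ⊥-elim (misses x p<x x≤q Ac c∋x)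
  ... | c′ , (there c′∈C , Ac′) , c′∋x = c′ , (c′∈C , Ac′) , c′∋x

  -- A finite union of closed intervals is closed, so it contains p once it contains (p, q].
  coversAbove⇒coveredBy-left-end : ∀ {A p q} → Decidable A → (C : List (Fin n)) → p < q →
    CoversAbove ((_∈ C) ∩ A) p q → CoveredBy S ((_∈ C) ∩ A) p
  coversAbove⇒coveredBy-left-end A? [] p<q cov with cov _ p<q ≤-refl
  ... | _ , (() , _) , _
  coversAbove⇒coveredBy-left-end {A} {p} {q} A? (c ∷ C) p<q cov = cases (A? c) (u S c ≤? p) (p ≤? v S c)
    where
    viaTail : ∀ {y} → p < y → y ≤ q → (∀ x → p < x → x ≤ y → A c → ¬ (S ∋ₛ c) x) →
      CoveredBy S ((_∈ c ∷ C) ∩ A) p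
    viaTail p<y y≤q misses = coveredBy-mono (Product.map₁ there)
      (coversAbove⇒coveredBy-left-end A? C p<y (coversAbove-drop (coversAbove-shrink y≤q cov) misses))

    cases : Dec (A c) → Dec (u S c ≤ p) → Dec (p ≤ v S c) → CoveredBy S ((_∈ c ∷ C) ∩ A) p
    cases (yes Ac) (yes uc≤p) (yes p≤vc) = c , (here refl , Ac) , uc≤p , p≤vc
    cases (no ¬Ac) _ _ = viaTail p<q ≤-refl λ _ _ _ Ac _ → ¬Ac Ac
    cases (yes _) (no uc≰p) _ =
      let z , p<z , z<uc , z<q = dense-below₂ (≰⇒> uc≰p) p<q
      in viaTail p<z (<⇒≤ z<q) λ x _ x≤z _ c∋x → <⇒≱ (≤-<-trans x≤z z<uc) (proj₁ c∋x)
    cases (yes _) (yes _) (no p≰vc) =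
      viaTail p<q ≤-refl λ x p<x _ _ c∋x → <⇒≱ (<-trans (≰⇒> p≰vc) p<x) (proj₂ c∋x)

  data Chain : ℚ → ℚ → List (Fin n) → Set where
    nil  : ∀ {p} → Chain p p []
    cons : ∀ {p q cs} i → u S i ≤ p → Chain (v S i) q cs → Chain p q (i ∷ cs)

  chain-reaches : ∀ {p q cs x} → Chain p q cs → p < x → x ≤ q →
    ∃ λ c → c ∈ cs × u S c < x × x ≤ v S c
  chain-reaches nil p<x x≤q = ⊥-elim (<⇒≱ p<x x≤q)
  chain-reaches {x = x} (cons i ui≤p chain) p<x x≤q with x ≤? v S i
  ... | yes x≤vi = i , here refl , ≤-<-trans ui≤p p<x , x≤vi
  ... | no x≰vi  = let c , c∈cs , reach = chain-reaches chain (≰⇒> x≰vi) x≤q in c , there c∈cs , reach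

  chain-coversAbove : ∀ {p q cs} → Chain p q cs → CoversAbove (_∈ cs) p q
  chain-coversAbove chain x p<x x≤q =
    let c , c∈cs , uc<x , x≤vc = chain-reaches chain p<x x≤q in c , c∈cs , <⇒≤ uc<x , x≤vc

  chain-split : ∀ {P : ℚ → Set} {p q cs} → Decidable P → Chain p q cs → ¬ P p → P q →
    ∃₂ λ before after → ∃₂ λ i m → cs ≡ before ++ i ∷ after ×
      Chain p (v S i) (before ∷ʳ i) × Chain m q (i ∷ after) × ¬ P m × P (v S i)
  chain-split P? nil ¬Pp Pq = ⊥-elim (¬Pp Pq)
  chain-split {p = p} P? (cons i ui≤p chain) ¬Pp Pq with P? (v S i)
  ... | yes Pvi = [] , _ , i , p , refl , cons i ui≤p nil , cons i ui≤p chain , ¬Pp , Pvi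
  ... | no ¬Pvi =
    let before , after , j , m , eq , upTo , from , ¬Pm , Pvj = chain-split P? chain ¬Pvi Pq
    in i ∷ before , after , j , m , cong (i ∷_) eq , cons i ui≤p upTo , from , ¬Pm , Pvj

  oga-chain : ∀ {A p β sel} → OGA S A p β sel → ∃ λ q → Chain p q sel × β ≤ q
  oga-chain {p = p} (stop β≤p) = p , nil , β≤p
  oga-chain (step i _ _ (ui≤p , _) _ rest) =
    let q , chain , β≤q = oga-chain rest in q , cons i ui≤p chain , β≤q

  oga-avail : ∀ {A p β sel} → OGA S A p β sel → (_∈ sel) ⊆ A
  oga-avail (step i _ Ai _ _ _)   (here refl)   = Ai
  oga-avail (step i _ _ _ _ rest) (there c∈sel) = proj₁ (oga-avail rest c∈sel)

  oga-covers : ∀ {A p β sel} → p < β → OGA S A p β sel → Covers S (_∈ sel) p β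
  oga-covers p<β (stop β≤p) _ _ _ = ⊥-elim (<⇒≱ p<β β≤p)
  oga-covers {p = p} p<β run@(step i _ _ (ui≤p , p≤vi) _ _) x p≤x x≤β with x ≤? p
  ... | yes x≤p = i , here refl , ≤-trans ui≤p p≤x , ≤-trans x≤p p≤vi
  ... | no x≰p  = let q , chain , β≤q = oga-chain run in chain-coversAbove chain x (≰⇒> x≰p) (≤-trans x≤β β≤q)

  oga-truncate : ∀ {A p β sel y} → y ≤ β → OGA S A p β sel →
    ∃₂ λ xs ys → sel ≡ xs ++ ys × OGA S A p y xs
  oga-truncate {p = p} {y = y} y≤β run with y ≤? p
  oga-truncate y≤β run                        | yes y≤p = [] , _ , refl , stop y≤p
  oga-truncate y≤β (stop β≤p)                 | no y≰p  = ⊥-elim (y≰p (≤-trans y≤β β≤p))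
  oga-truncate y≤β (step i _ Ai i∋p best rest) | no y≰p  =
    let xs , ys , eq , run = oga-truncate y≤β rest
    in i ∷ xs , ys , cong (i ∷_) eq , step i (≰⇒> y≰p) Ai i∋p best run

  -- Greedy stays ahead: the sensor c of C containing p ends no later than OGA's choice i,
  -- so C without c still covers everything beyond v i.
  oga-optimal : ∀ {A p β q sel} → Decidable A → OGA S A p β sel → (C : List (Fin n)) →
    CoversAbove ((_∈ C) ∩ A) p q → β ≤ q → length sel ≤ℕ length C
  oga-optimal A? (stop _) C _ _ = z≤n
  oga-optimal {A} {q = q} A? (step i p<β Ai i∋p best rest) C cov β≤q =
    let c , (c∈C , Ac) , c∋p = coversAbove⇒coveredBy-left-end A? C (<-≤-trans p<β β≤q) cov
        rest-bound = oga-optimal (A? ∩? λ j → ¬? (j ≟ i)) rest (removeₛ c C)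
                       (cov′ c∈C (proj₁ (best c Ac c∋p))) β≤q
    in ≤ℕ-trans (s≤s rest-bound) (length-removeₛ c∈C)
    where
    cov′ : ∀ {c} → c ∈ C → v S c ≤ v S i → CoversAbove ((_∈ removeₛ c C) ∩ (A ∩ (_≢ i))) (v S i) q
    cov′ {c} c∈C vc≤vi x vi<x x≤q with cov x (≤-<-trans (proj₂ i∋p) vi<x) x≤q
    ... | c′ , (c′∈C , Ac′) , c′∋x = c′ , (∈-removeₛ⁺ c′∈C c′≢c , Ac′ , c′≢i) , c′∋x
      where
      c′≢c : c′ ≢ c
      c′≢c refl = <⇒≱ vi<x (≤-trans (proj₂ c′∋x) vc≤vi)
      c′≢i : c′ ≢ i
      c′≢i refl = <⇒≱ vi<x (proj₂ c′∋x)

module GapMending {n} {S : Sensors n} {a b : ℚ} {old : List (Fin n)} (old-run : OGA S (λ _ → ⊤) a b old)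
  {s* : Fin n} (s*∈old : s* ∈ old) {uG vG : ℚ} (uG<vG : uG < vG) (a≤uG : a ≤ uG) (vG≤b : vG ≤ b)
  (gap-uncovered : ∀ x → uG < x → x < vG → ¬ CoveredBy S (_∈ removeₛ s* old) x)
  (uncovered⇒in-gap : ∀ x → a ≤ x → x ≤ b → ¬ CoveredBy S (_∈ removeₛ s* old) x → uG ≤ x × x ≤ vG)
  {new : List (Fin n)} (new-run : OGA S (_≢ s*) a b new)
  {mend : List (Fin n)} (mend-run : OGA S (_∉ old) uG vG mend)
  where

  open DecMembership (_≟_ {n}) using (_∈?_)

  R : List (Fin n)
  R = removeₛ s* old

  a<b : a < b
  a<b = ≤-<-trans a≤uG (<-≤-trans uG<vG vG≤b)

  gap-only-failed : ∀ {c z} → c ∈ old → uG < z → z < vG → (S ∋ₛ c) z → c ≡ s*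
  gap-only-failed {c} {z} c∈old uG<z z<vG c∋z with c ≟ s*
  ... | yes c≡s* = c≡s*
  ... | no c≢s*  = ⊥-elim (gap-uncovered z uG<z z<vG (c , ∈-removeₛ⁺ c∈old c≢s* , c∋z))

  failed-∋-gap : ∀ z → uG < z → z < vG → (S ∋ₛ s*) z
  failed-∋-gap z uG<z z<vG
    with oga-covers S a<b old-run z (≤-trans a≤uG (<⇒≤ uG<z)) (≤-trans (<⇒≤ z<vG) vG≤b)
  ... | c , c∈old , c∋z with gap-only-failed c∈old uG<z z<vG c∋z
  ... | refl = c∋z

  failed-coversAbove-gap : CoversAbove S (_≡ s*) uG vG
  failed-coversAbove-gap x uG<x x≤vG =
    let u*≤uG , vG≤v* = closure-⊆ uG<vG failed-∋-gap
    in s* , refl , ≤-trans u*≤uG (<⇒≤ uG<x) , ≤-trans x≤vG vG≤v*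

  lower : length new ≤ℕ length (R ++ mend)
  lower = oga-optimal S (λ j → ¬? (j ≟ s*)) new-run (R ++ mend) cover ≤-refl
    where
    cover : CoversAbove S ((_∈ R ++ mend) ∩ (_≢ s*)) a b
    cover x a<x x≤b with coveredBy? S R x
    ... | yes (c , c∈R , c∋x) = c , (∈-++⁺ˡ c∈R , proj₂ (∈-removeₛ⁻ {xs = old} c∈R)) , c∋x
    ... | no ¬R-covers with uncovered⇒in-gap x (<⇒≤ a<x) x≤b ¬R-covers
    ... | uG≤x , x≤vG =
      let c , c∈mend , c∋x = oga-covers S uG<vG mend-run x uG≤x x≤vG
      in c , (∈-++⁺ʳ R c∈mend , λ { refl → oga-avail S mend-run c∈mend s*∈old }) , c∋x

  -- The old run truncated at y′ ∈ (uG, y) stays ahead of C and, having passed uG, contains s*,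
  -- which spans the gap.
  old-bound : ∀ {y m q} (C D : List (Fin n)) → CoversAbove S (_∈ C) a y → uG < y →
    CoversAbove S (_∈ D) m q → m ≤ vG → b ≤ q → length old ≤ℕ length C + length D
  old-bound C D C-covers uG<y D-covers m≤vG b≤q =
    let y′ , uG<y′ , y′<y , y′<vG = dense-below₂ uG<y uG<vG
        xs , _ , old≡ , prefix-run = oga-truncate S (≤-trans (<⇒≤ y′<vG) vG≤b) old-run
        prefix-covers = oga-covers S (≤-<-trans a≤uG uG<y′) prefix-run
        c , c∈xs , c∋y′ = prefix-covers y′ (≤-trans a≤uG (<⇒≤ uG<y′)) ≤-refl
        c≡s* = gap-only-failed (subst (c ∈_) (sym old≡) (∈-++⁺ˡ c∈xs)) uG<y′ y′<vG c∋y′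
        s*∈xs = subst (_∈ xs) c≡s* c∈xs
        xs-covers = coversAbove-join S (covers⇒coversAbove S prefix-covers) (<⇒≤ uG<y′)
                      (coversAbove-mono S (λ { refl → s*∈xs }) failed-coversAbove-gap)
        cover = coversAbove-join S (coversAbove-mono S ∈-++⁺ˡ xs-covers) m≤vG
                  (coversAbove-mono S (∈-++⁺ʳ xs) D-covers)
    in begin
      length old          ≤⟨ oga-optimal S (λ _ → yes tt) old-run (xs ++ D) (coversAbove-mono S (_, tt) cover) b≤q ⟩
      length (xs ++ D)    ≡⟨ length-++ xs ⟩
      length xs + length D ≤⟨ +-monoˡ-≤ (length D)
                               (oga-optimal S (λ _ → yes tt) prefix-run C (coversAbove-mono S (_, tt) C-covers) (<⇒≤ y′<y)) ⟩
      length C + length D ∎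
    where open ≤-Reasoning

  -- Each sensor of K meets the open gap, which no old sensor other than s* does.
  mend-bound : ∀ {K q r} → Chain S q r K → q ≤ uG → vG ≤ r → (_∈ K) ⊆ (_∈ new) → length mend ≤ℕ length K
  mend-bound {K} chain q≤uG vG≤r K⊆new = oga-optimal S (λ j → ¬? (j ∈? old)) mend-run K K-covers ≤-refl
    where
    K-covers : CoversAbove S ((_∈ K) ∩ (_∉ old)) uG vG
    K-covers x uG<x x≤vG =
      let c , c∈K , uc<x , x≤vc = chain-reaches S chain (≤-<-trans q≤uG uG<x) (≤-trans x≤vG vG≤r)
          z , uG<z , uc<z , z<x = dense-above₂ uG<x uc<x
          c∋z = <⇒≤ uc<z , ≤-trans (<⇒≤ z<x) x≤vc
      in c , (c∈K , λ c∈old → oga-avail S new-run (K⊆new c∈K) (gap-only-failed c∈old uG<z (<-≤-trans z<x x≤vG) c∋z))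
           , <⇒≤ uc<x , x≤vc

  upper : length (R ++ mend) ≤ℕ length new + 1
  upper with oga-chain S new-run
  ... | q , new-chain , b≤q
    with chain-split S (uG <?_) new-chain (λ uG<a → <⇒≱ uG<a a≤uG) (<-≤-trans uG<vG (≤-trans vG≤b b≤q))
  ... | pre , rest , first , start , new≡ , to-first , from-first , uG≮start , uG<v-first
    with chain-split S (vG ≤?_) from-first (λ vG≤start → <⇒≱ (≤-<-trans (≮⇒≥ uG≮start) uG<vG) vG≤start)
           (≤-trans vG≤b b≤q)
  ... | mid , post , last , start′ , first∷rest≡ , to-last , from-last , vG≰start′ , vG≤v-last = begin
      length (R ++ mend)      ≡⟨ length-++ R ⟩
      length R + length mend  ≤⟨ +-mono-≤ R-bound mend-bound′ ⟩
      c + d + k               ≡⟨ length-new ⟩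
      length new + 1          ∎
    where
    open ≤-Reasoning
    c = length (pre ∷ʳ first)
    k = length (mid ∷ʳ last)
    d = length post

    R-bound : length R ≤ℕ c + d
    R-bound = ≤-pred (≤ℕ-trans (length-removeₛ s*∈old) (≤ℕ-trans
      (old-bound (pre ∷ʳ first) (last ∷ post) (chain-coversAbove S to-first) uG<v-first
                 (chain-coversAbove S from-last) (<⇒≤ (≰⇒> vG≰start′)) b≤q)
      (≤-reflexive (+-suc c d))))

    mend-bound′ : length mend ≤ℕ k
    mend-bound′ = mend-bound to-last (≮⇒≥ uG≮start) vG≤v-last λ c∈K →
      subst (_ ∈_) (sym new≡) (∈-++⁺ʳ pre (subst (_ ∈_) (sym first∷rest≡) (∈-∷ʳ-++⁺ mid post c∈K)))

    length-new : c + d + k ≡ length new + 1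
    length-new = E.begin
      c + d + k              E.≡⟨ trans (+-assoc c d k) (cong (c +_) (+-comm d k)) ⟩
      c + (k + d)            E.≡⟨ cong (c +_) (trans (length-∷ʳ-++ mid last post) (cong length (sym first∷rest≡))) ⟩
      c + suc (length rest)  E.≡⟨ +-suc c (length rest) ⟩
      suc (c + length rest)  E.≡⟨ cong suc (trans (length-∷ʳ-++ pre first rest) (cong length (sym new≡))) ⟩
      suc (length new)       E.≡⟨ +-comm 1 (length new) ⟩
      length new + 1         E.∎
      where module E = ≡-Reasoning

theorem5 : ∀ {n} (S : Sensors n) (a b : ℚ)
  -- S^old : the sensors selected by continuous OGA on [a,b] using all of S
  (old : List (Fin n)) → OGA S (λ _ → ⊤) a b old →
  -- the failing sensor s* ∈ S^old
  (s* : Fin n) → s* ∈ old →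
  -- the gap [uG , vG] : closure of the part of [a,b] left uncovered by S^old ∖ {s*}
  (uG vG : ℚ) → uG < vG → a ≤ uG → vG ≤ b →
  (∀ x → uG < x → x < vG → ¬ CoveredBy S (λ j → j ∈ removeₛ s* old) x) →
  (∀ x → a ≤ x → x ≤ b → ¬ CoveredBy S (λ j → j ∈ removeₛ s* old) x →
     (uG ≤ x) × (x ≤ vG)) →
  -- S ∖ {s*} still covers [a,b]
  Covers S (λ j → j ≢ s*) a b →
  -- new run of continuous OGA on [a,b] using S ∖ {s*}
  (new : List (Fin n)) → OGA S (λ j → j ≢ s*) a b new →
  -- LOGM: continuous OGA on the gap, using only the sensors not in S^old
  (mend : List (Fin n)) → OGA S (λ j → j ∉ old) uG vG mend →
  (length new ≤ℕ length (removeₛ s* old ++ mend))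
    × (length (removeₛ s* old ++ mend) ≤ℕ length new + 1)
theorem5 S a b old old-run s* s*∈old uG vG uG<vG a≤uG vG≤b gap-uncovered uncovered⇒in-gap _
         new new-run mend mend-run = lower , upper
  where
  open GapMending old-run s*∈old uG<vG a≤uG vG≤b gap-uncovered uncovered⇒in-gap new-run mend-run
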